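{- For all integers $m>k>n\ge 2$, $EX_n^m\subseteq EX_n^k$.
   Context: For $n\ge 2$, $RB_L(n)$ denotes the set of rooted binary trees (every non-leaf vertex has exactly two unordered children) with $n$ leaves labelled bijectively by $[n]=\{1,\dots,n\}$, up to label-preserving isomorphism. For a rooted binary tree $Q$ and a nonempty set $S$ of its leaves, the restriction $Q|_S$ is the rooted binary tree whose vertices are the elements of $S$ together with the lowest common ancestors in $Q$ of pairs of elements of $S$, with the ancestor relation inherited from $Q$ (equivalently: delete all leaves not in $S$ and suppress the resulting vertices with a single child). A distribution $p$ on $RB_L(n)$ is exchangeable if $p(Q)=p(\sigma Q)$ for all $Q$ and all permutations $\sigma$ of $[n]$ ($\sigma Q$ = relabel leaves by $\sigma$); $EX_n$ is the set of exchangeable distributions on $RB_L(n)$. For $m\ge n$ and a distribution $p_m$ on $RB_L(m)$, the marginalization $\pi_n(p_m)$ is the distribution on $RB_L(n)$ given by $\pi_n(p_m)(T)=\sum_{\{S\in RB_L(m)\,:\,S|_{[n]}=T\}}p_m(S)$. For $m\ge n$, $EX_n^m=\pi_n(EX_m)$ (the exchangeable distributions on $RB_L(n)$ that are $m$-sampling consistent).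
   Formalization: All distributions involved, on RB_L(n), RB_L(m) and RB_L(k), take rational values. -}

module Defs where

-- Rooted binary leaf-labelled trees are encoded by their cluster systems
-- (the leaf sets below each vertex), which determine a tree up to
-- label-preserving isomorphism.

open import Data.Bool using (Bool; true; false; _∧_; _∨_; not; T; if_then_else_)
open import Data.Bool.Properties using () renaming (_≟_ to _≟B_)
open import Data.Nat as ℕ using (ℕ; zero; suc)
open import Data.Fin using (Fin; inject≤)
open import Data.Fin.Permutation using (Permutation′; _⟨$⟩ʳ_)
open import Data.List as List using (List; []; _∷_; filter; length; concatMap; allFin)
import Data.List.Base as LB
open import Data.Vec as Vec using (Vec; lookup; tabulate)
import Data.Vec.Properties as VecP
open import Data.Rational as ℚ using (ℚ; 0ℚ; 1ℚ; _+_)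
open import Data.Product using (Σ; _×_; _,_; proj₁; proj₂)
open import Relation.Nullary.Decidable using (⌊_⌋)
open import Relation.Binary.PropositionalEquality using (_≡_)

Sub : ℕ → Set
Sub n = Vec Bool n

allVecs : (k : ℕ) → List (Vec Bool k)
allVecs zero    = Vec.[] ∷ []
allVecs (suc k) = concatMap (λ v → (false Vec.∷ v) ∷ (true Vec.∷ v) ∷ []) (allVecs k)

_==_ : ∀ {n} → Sub n → Sub n → Bool
C == D = ⌊ VecP.≡-dec _≟B_ C D ⌋

allB : ∀ {n} → Vec Bool n → Bool
allB = Vec.foldr _ _∧_ true

anyL : ∀ {A : Set} → (A → Bool) → List A → Bool
anyL f = LB.foldr (λ x b → f x ∨ b) false

allL : ∀ {A : Set} → (A → Bool) → List A → Bool
allL f = LB.foldr (λ x b → f x ∧ b) true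

_⊆_ : ∀ {n} → Sub n → Sub n → Bool
C ⊆ D = allB (Vec.zipWith (λ a b → not a ∨ b) C D)

_⊂_ : ∀ {n} → Sub n → Sub n → Bool
C ⊂ D = (C ⊆ D) ∧ not (C == D)

disjoint : ∀ {n} → Sub n → Sub n → Bool
disjoint C D = allB (Vec.zipWith (λ a b → not (a ∧ b)) C D)

isEmpty : ∀ {n} → Sub n → Bool
isEmpty C = allB (Vec.map not C)

size : ∀ {n} → Sub n → ℕ
size C = Vec.foldr _ (λ b k → if b then suc k else k) 0 C

full : ∀ n → Sub n
full n = Vec.replicate n true

singleton : ∀ {n} → Fin n → Sub n
singleton i = tabulate (λ j → ⌊ i Data.Fin.≟ j ⌋)
  where import Data.Fin

record Family (n : ℕ) : Set where
  constructor fam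
  field mask : Vec Bool (length (allVecs n))
open Family public

mkFamily : ∀ {n} → (Sub n → Bool) → Family n
mkFamily {n} f = fam (Vec.map f (Vec.fromList (allVecs n)))

members : ∀ {n} → Family n → List (Sub n)
members {n} F =
  LB.map proj₂ (filter (λ p → proj₁ p ≟B true)
                       (Vec.toList (Vec.zip (mask F) (Vec.fromList (allVecs n)))))

_∈F_ : ∀ {n} → Sub n → Family n → Bool
C ∈F F = anyL (λ D → C == D) (members F)

children : ∀ {n} → Family n → Sub n → List (Sub n)
children F C =
  filter (λ D → ((D ⊂ C) ∧ not (anyL (λ E → (D ⊂ E) ∧ (E ⊂ C)) (members F))) ≟B true)
         (members F)

isTree : ∀ {n} → Family n → Bool
isTree {n} F =
  allL (λ C → not (isEmpty C)) (members F)
  ∧ (full n ∈F F)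
  ∧ allL (λ i → singleton i ∈F F) (allFin n)
  ∧ allL (λ C → allL (λ D → (C ⊆ D) ∨ (D ⊆ C) ∨ disjoint C D) (members F)) (members F)
  ∧ allL (λ C → (if 2 ℕ.≤ᵇ size C then ⌊ length (children F C) ℕ.≟ 2 ⌋ else true))
         (members F)

trees : ∀ n → List (Family n)
trees n = filter (λ F → isTree F ≟B true) (LB.map fam (allVecs (length (allVecs n))))

RBL : ℕ → Set
RBL n = Σ (Family n) (λ F → T (isTree F))

restrictSub : ∀ {n m} → .(n ℕ.≤ m) → Sub m → Sub n
restrictSub n≤m C = tabulate (λ i → lookup C (inject≤ i n≤m))

restrict : ∀ {n m} → .(n ℕ.≤ m) → Family m → Family n
restrict n≤m F =
  mkFamily (λ D → anyL (λ C → not (isEmpty (restrictSub n≤m C)) ∧ (restrictSub n≤m C == D))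
                       (members F))

-- σQ: leaf i relabelled σ(i); D is a cluster of σQ iff σ⁻¹(D) is one of Q
relabel : ∀ {n} → Permutation′ n → Family n → Family n
relabel σ F = mkFamily (λ D → tabulate (λ i → lookup D (σ ⟨$⟩ʳ i)) ∈F F)

-- Distributions (rational-valued), only values on trees matter

Dist : ℕ → Set
Dist n = Family n → ℚ

sumOver : ∀ {n} → List (Family n) → Dist n → ℚ
sumOver xs p = LB.foldr (λ F q → p F + q) 0ℚ xs

IsDistribution : ∀ n → Dist n → Set
IsDistribution n p = (∀ (Q : Family n) → T (isTree Q) → 0ℚ ℚ.≤ p Q)
                     × sumOver (trees n) p ≡ 1ℚ

Exchangeable : ∀ n → Dist n → Set
Exchangeable n p = ∀ (σ : Permutation′ n) (Q : Family n) → T (isTree Q) →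
                   p (relabel σ Q) ≡ p Q

EX : ∀ n → Dist n → Set
EX n p = IsDistribution n p × Exchangeable n p

marginal : ∀ {n m} → .(n ℕ.≤ m) → Dist m → Dist n
marginal {n} {m} n≤m pm Tr =
  sumOver (filter (λ S → VecP.≡-dec _≟B_ (mask (restrict n≤m S)) (mask Tr)) (trees m)) pm

-- EX_n^m = π_n(EX_m)  (equality of distributions on RB_L(n))
EXsc : ∀ n m → .(n ℕ.≤ m) → Dist n → Set
EXsc n m n≤m p = Σ (Dist m) (λ pm → EX m pm ×
                   (∀ (Q : Family n) → T (isTree Q) → p Q ≡ marginal n≤m pm Q))

module Submission where

-- If p = π_n(p_m) with p_m ∈ EX_m, then p_k = π_k(p_m) shows
-- p ∈ EX_n^k.  It is a distribution because restriction maps RB_L(m) into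
-- RB_L(k), so every tree of RB_L(m) is counted in exactly one tree of RB_L(k);
-- it is exchangeable because a permutation σ of [k] extends to a permutation
-- of [m] fixing the other leaves, and restriction commutes with relabelling;
-- and π_n(p_k) = π_n(p_m) because restricting to [k] and then to [n] is
-- restricting to [n].
--
-- Trees are treated as binary hierarchies.  Restriction and relabelling are
-- both pullbacks C ↦ f⁻¹(C) along injections f : [k] → [m], and the pullback
-- of a binary hierarchy is one again: if C = A ⊔ B and f⁻¹(C) has two points,
-- either f⁻¹(C) = f⁻¹(A) ⊔ f⁻¹(B) with both parts nonempty, or one preimage
-- is empty and f⁻¹(C) is the preimage of the other, strictly smaller, part.

open import Defs renaming (_⊆_ to _⊆ᵇ_; _⊂_ to _⊂ᵇ_)

open import Algebra.Bundles using (CommutativeMonoid)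
open import Data.Bool using (Bool; true; false; T; not; _∧_; _∨_; if_then_else_)
open import Data.Bool.Properties using (T-∧; T-∨; T-≡; ⇔→≡) renaming (_≟_ to _≟ᵇ_)
open import Data.Empty using (⊥; ⊥-elim)
open import Data.Fin as Fin using (Fin; zero; suc; toℕ; fromℕ<; inject≤)
open import Data.Fin.Permutation
  using (Permutation′; permutation; _⟨$⟩ʳ_; _⟨$⟩ˡ_; inverseˡ; inverseʳ; flip)
open import Data.Fin.Properties
  using (suc-injective; toℕ-injective; toℕ-fromℕ<; toℕ-inject≤; toℕ<n;
         inject≤-injective; inject≤-idempotent)
open import Data.Fin.Subset using (Subset; ⊤; ⁅_⁆; _∪_; _⊆_; _⊂_; Nonempty; ∣_∣)
  renaming (_∈_ to _∈ₛ_; _∉_ to _∉ₛ_)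
open import Data.Fin.Subset.Properties
  using (⊆-antisym; _∈?_; _⊆?_; _⊂?_; x∈⁅x⁆; x∈⁅y⁆⇒x≡y; drop-there; out⊆-⇔; in⊆in-⇔;
         x∈p∪q⁻; x∈p∪q⁺; p⊆p∪q; q⊆p∪q; ∪-comm; ∪-identityˡ; p⊂q⇒∣p∣<∣q∣; ∈⊤;
         nonempty?; Empty-unique)
open import Data.List as List using (List; []; _∷_; length; filter; allFin)
open import Data.List.Extrema.Nat using (argmax; argmax-all; f[xs]≤f[argmax])
open import Data.List.Membership.Propositional using (_∈_; _∉_)
open import Data.List.Membership.Propositional.Properties
  using (∈-filter⁺; ∈-filter⁻; ∈-allFin; ∈-map⁺)
open import Data.List.Relation.Unary.All as All using (All; []; _∷_)
open import Data.List.Relation.Unary.All.Properties using (¬Any⇒All¬; All¬⇒¬Any)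
open import Data.List.Relation.Unary.AllPairs using ([]; _∷_)
open import Data.List.Relation.Unary.Any using (here; there)
open import Data.List.Relation.Unary.Unique.Propositional using (Unique)
open import Data.List.Relation.Unary.Unique.Propositional.Properties using (filter⁺; map⁺)
open import Data.Nat using (ℕ; zero; suc; z≤n; s≤s; _≤_; _<_; _<?_)
open import Data.Nat.Induction using (<-wellFounded)
open import Data.Nat.Properties using (≤-trans; ≤ᵇ⇒≤; ≤⇒≤ᵇ; <⇒≱; <⇒≤; <-trans)
open import Data.Product using (∃₂; ∃-syntax; _×_; _,_; proj₁; proj₂)
open import Data.Rational as ℚ using (ℚ; 0ℚ; 1ℚ; _+_; _*_)
open import Data.Rational.Properties
  using (+-identityˡ; +-identityʳ; *-identityˡ; *-zeroˡ; *-zeroʳ; *-distribˡ-+; +-mono-≤;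
         +-0-commutativeMonoid; *-1-commutativeMonoid)
  renaming (≤-refl to ℚ-≤-refl)
open import Data.Sum using (_⊎_; inj₁; inj₂; [_,_]) renaming (map to ⊎-map)
open import Data.Sum.Function.Propositional using (_⊎-⇔_)
open import Data.Vec.Base as Vec using (Vec; lookup; tabulate)
open import Data.Vec.Properties
  using ([]=⇒lookup; lookup⇒[]=; lookup∘tabulate; tabulate∘lookup; tabulate-cong; ≡-dec)
open import Function using (_∘_; _⇔_; mk⇔; Equivalence; id; const; _$_)
open import Function.Construct.Composition using (_⇔-∘_)
open import Function.Construct.Symmetry using (⇔-sym)
open import Function.Definitions using (Injective)
open import Induction.WellFounded using (Acc; acc)
open import Relation.Binary.Definitions using (DecidableEquality)
open import Relation.Binary.PropositionalEquality
  using (_≡_; _≢_; _≗_; refl; sym; trans; cong; cong₂; subst; module ≡-Reasoning)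
open import Relation.Nullary using (Dec; yes; no; ¬_; does; contradiction)
open import Relation.Nullary.Decidable
  using (map′; ⌊_⌋; toWitness; fromWitness; _×-dec_; does-⇔)

open import Algebra.Properties.CommutativeSemigroup
  (CommutativeMonoid.commutativeSemigroup +-0-commutativeMonoid) using (interchange)
open import Algebra.Properties.CommutativeSemigroup
  (CommutativeMonoid.commutativeSemigroup *-1-commutativeMonoid) using (x∙yz≈y∙xz)

open Equivalence using (to; from)

private
  variable
    n k m : ℕ
    A : Set
    x y : A
    xs : List A
    C D : Subset n
    F G : Family n
    S : Family m

T-anyL : {f : A → Bool} → T (anyL f xs) ⇔ (∃[ x ] x ∈ xs × T (f x))
T-anyL {xs = []} = mk⇔ (λ ()) (λ ())
T-anyL {xs = x ∷ xs} {f = f} = mk⇔ to′ from′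
  where
  to′ : T (f x ∨ anyL f xs) → ∃[ y ] y ∈ x ∷ xs × T (f y)
  to′ t with to T-∨ t
  ... | inj₁ fx = x , here refl , fx
  ... | inj₂ rest = let (y , y∈ , fy) = to T-anyL rest in y , there y∈ , fy
  from′ : ∃[ y ] y ∈ x ∷ xs × T (f y) → T (f x ∨ anyL f xs)
  from′ (y , here refl , fy) = from T-∨ (inj₁ fy)
  from′ (y , there y∈ , fy) = from (T-∨ {f x}) (inj₂ (from T-anyL (y , y∈ , fy)))

T-allL : {f : A → Bool} → T (allL f xs) ⇔ (∀ {x} → x ∈ xs → T (f x))
T-allL {xs = []} = mk⇔ (λ _ ()) (const _)
T-allL {xs = x ∷ xs} {f = f} = mk⇔ to′ from′
  where
  to′ : T (f x ∧ allL f xs) → ∀ {y} → y ∈ x ∷ xs → T (f y)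
  to′ t (here refl) = proj₁ (to T-∧ t)
  to′ t (there y∈) = to T-allL (proj₂ (to (T-∧ {f x}) t)) y∈
  from′ : (∀ {y} → y ∈ x ∷ xs → T (f y)) → T (f x ∧ allL f xs)
  from′ h = from T-∧ (h (here refl) , from T-allL (h ∘ there))

T-if-else-true : ∀ b {c} → T (if b then c else true) ⇔ (T b → T c)
T-if-else-true true = mk⇔ const (_$ _)
T-if-else-true false = mk⇔ (λ _ ()) (const _)

T-⌊⌋ : (d : Dec A) → T ⌊ d ⌋ ⇔ A
T-⌊⌋ d = mk⇔ toWitness fromWitness

T-not : ∀ {b} → T (not b) ⇔ (¬ T b)
T-not {true} = mk⇔ (λ ()) (_$ _)
T-not {false} = mk⇔ (λ _ ()) (const _)

Disjoint : Subset n → Subset n → Set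
Disjoint C D = ∀ {x} → x ∈ₛ C → x ∉ₛ D

AtLeastTwo : Subset n → Set
AtLeastTwo C = ∃₂ λ x y → x ∈ₛ C × y ∈ₛ C × x ≢ y

Disjoint-sym : Disjoint C D → Disjoint D C
Disjoint-sym C∩D=∅ x∈D x∈C = C∩D=∅ x∈C x∈D

∪-least : ∀ {A B} → A ⊆ C → B ⊆ C → A ∪ B ⊆ C
∪-least A⊆C B⊆C x∈ = [ A⊆C , B⊆C ] (x∈p∪q⁻ _ _ x∈)

⊆-∪-disjointʳ : ∀ {A B} → C ⊆ A ∪ B → Disjoint C B → C ⊆ A
⊆-∪-disjointʳ C⊆A∪B C∩B=∅ x∈ = [ id , ⊥-elim ∘ C∩B=∅ x∈ ] (x∈p∪q⁻ _ _ (C⊆A∪B x∈))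

⊆-∪-disjointˡ : ∀ {A B} → C ⊆ A ∪ B → Disjoint C A → C ⊆ B
⊆-∪-disjointˡ C⊆A∪B C∩A=∅ x∈ = [ ⊥-elim ∘ C∩A=∅ x∈ , id ] (x∈p∪q⁻ _ _ (C⊆A∪B x∈))

∪-emptyˡ : ∀ {A B : Subset n} → ¬ Nonempty A → A ∪ B ≡ B
∪-emptyˡ {B = B} ¬ne = trans (cong (_∪ B) (Empty-unique ¬ne)) (∪-identityˡ B)

∪-emptyʳ : ∀ {A B : Subset n} → ¬ Nonempty B → A ∪ B ≡ A
∪-emptyʳ {A = A} {B} ¬ne = trans (∪-comm A B) (∪-emptyˡ ¬ne)

⊆×≢⇒⊂ : C ⊆ D → C ≢ D → C ⊂ D
⊆×≢⇒⊂ {C = C} {D = D} C⊆D C≢D with C ⊂? D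
... | yes C⊂D = C⊂D
... | no C⊄D = contradiction (⊆-antisym C⊆D D⊆C) C≢D
  where
  D⊆C : D ⊆ C
  D⊆C {x} x∈D with x ∈? C
  ... | yes x∈C = x∈C
  ... | no x∉C = ⊥-elim (C⊄D (C⊆D , x , x∈D , x∉C))

⊂⇔⊆×≢ : C ⊂ D ⇔ (C ⊆ D × C ≢ D)
⊂⇔⊆×≢ = mk⇔ (λ (C⊆D , x , x∈D , x∉C) → C⊆D , λ { refl → x∉C x∈D })
             (λ (C⊆D , C≢D) → ⊆×≢⇒⊂ C⊆D C≢D)

⁅⁆⊂ : ∀ {x} → x ∈ₛ C → AtLeastTwo C → ⁅ x ⁆ ⊂ C
⁅⁆⊂ {C = C} {x} x∈ (y , z , y∈ , z∈ , y≢z) = ⁅x⁆⊆C , other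
  where
  ⁅x⁆⊆C : ⁅ x ⁆ ⊆ C
  ⁅x⁆⊆C w∈ = subst (_∈ₛ C) (sym (x∈⁅y⁆⇒x≡y x w∈)) x∈
  other : ∃[ w ] w ∈ₛ C × w ∉ₛ ⁅ x ⁆
  other with x Fin.≟ y
  ... | yes refl = z , z∈ , y≢z ∘ sym ∘ x∈⁅y⁆⇒x≡y x
  ... | no x≢y = y , y∈ , x≢y ∘ sym ∘ x∈⁅y⁆⇒x≡y x

∈⇔lookup : ∀ {i} → i ∈ₛ C ⇔ lookup C i ≡ true
∈⇔lookup = mk⇔ []=⇒lookup (lookup⇒[]= _ _)

∈-tabulate : ∀ {g : Fin n → Bool} {x} → x ∈ₛ tabulate g ⇔ g x ≡ true
∈-tabulate {g = g} {x} = mk⇔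
  (λ x∈ → trans (sym (lookup∘tabulate g x)) (to ∈⇔lookup x∈))
  (λ gx → from ∈⇔lookup (trans (lookup∘tabulate g x) gx))

T-== : T (C == D) ⇔ C ≡ D
T-== {C = C} {D} = T-⌊⌋ (≡-dec _≟ᵇ_ C D)

T-not-isEmpty : (C : Subset n) → T (not (isEmpty C)) ⇔ Nonempty C
T-not-isEmpty Vec.[] = mk⇔ (λ ()) (λ ())
T-not-isEmpty (true Vec.∷ C) = mk⇔ (const (zero , Vec.here)) (const _)
T-not-isEmpty (false Vec.∷ C) = mk⇔
  (λ t → let (i , i∈) = to (T-not-isEmpty C) t in suc i , Vec.there i∈)
  (λ { (zero , ()) ; (suc i , i∈) → from (T-not-isEmpty C) (i , drop-there i∈) })

T-⊆ᵇ : (C D : Subset n) → T (C ⊆ᵇ D) ⇔ C ⊆ D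
T-⊆ᵇ Vec.[] Vec.[] = mk⇔ (λ _ ()) (const _)
T-⊆ᵇ (false Vec.∷ C) (b Vec.∷ D) = out⊆-⇔ ⇔-∘ T-⊆ᵇ C D
T-⊆ᵇ (true Vec.∷ C) (true Vec.∷ D) = in⊆in-⇔ ⇔-∘ T-⊆ᵇ C D
T-⊆ᵇ (true Vec.∷ C) (false Vec.∷ D) = mk⇔ (λ ()) (λ C⊆D → contradiction (C⊆D Vec.here) λ ())

disjoint-∷ : ∀ {a b} → (zero ∈ₛ a Vec.∷ C → zero ∉ₛ b Vec.∷ D) →
             Disjoint C D ⇔ Disjoint (a Vec.∷ C) (b Vec.∷ D)
disjoint-∷ head-disjoint = mk⇔
  (λ C∩D=∅ → λ { {zero} x∈ y∈ → head-disjoint x∈ y∈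
               ; {suc x} x∈ y∈ → C∩D=∅ (drop-there x∈) (drop-there y∈) })
  (λ C∩D=∅ {_} x∈ y∈ → C∩D=∅ (Vec.there x∈) (Vec.there y∈))

T-disjoint : (C D : Subset n) → T (disjoint C D) ⇔ Disjoint C D
T-disjoint Vec.[] Vec.[] = mk⇔ (λ _ {x} → λ ()) (const _)
T-disjoint (true Vec.∷ C) (true Vec.∷ D) = mk⇔ (λ ()) (λ C∩D=∅ → C∩D=∅ Vec.here Vec.here)
T-disjoint (true Vec.∷ C) (false Vec.∷ D) = disjoint-∷ (λ _ ()) ⇔-∘ T-disjoint C D
T-disjoint (false Vec.∷ C) (b Vec.∷ D) = disjoint-∷ (λ ()) ⇔-∘ T-disjoint C D

T-⊂ᵇ : (C D : Subset n) → T (C ⊂ᵇ D) ⇔ C ⊂ D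
T-⊂ᵇ C D = mk⇔
  (λ t → let (C⊆D , C≠D) = to T-∧ t in
         ⊆×≢⇒⊂ (to (T-⊆ᵇ C D) C⊆D) (to T-not C≠D ∘ from T-==))
  (λ C⊂D → let (C⊆D , C≢D) = to ⊂⇔⊆×≢ C⊂D in
           from T-∧ (from (T-⊆ᵇ C D) C⊆D , from T-not (C≢D ∘ to T-==)))

singleton≡⁅⁆ : (i : Fin n) → singleton i ≡ ⁅ i ⁆
singleton≡⁅⁆ i = ⊆-antisym
  (λ x∈ → subst (_∈ₛ ⁅ i ⁆) (toWitness (from T-≡ (to ∈-tabulate x∈))) (x∈⁅x⁆ i))
  (λ x∈ → from ∈-tabulate (to T-≡ (fromWitness (sym (x∈⁅y⁆⇒x≡y i x∈)))))

nonempty-outside : Nonempty C ⇔ Nonempty (false Vec.∷ C)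
nonempty-outside = mk⇔ (λ (i , i∈) → suc i , Vec.there i∈)
                       (λ { (zero , ()) ; (suc i , i∈) → i , drop-there i∈ })

0<size⇔Nonempty : (C : Subset n) → 0 < size C ⇔ Nonempty C
0<size⇔Nonempty Vec.[] = mk⇔ (λ ()) (λ ())
0<size⇔Nonempty (true Vec.∷ C) = mk⇔ (const (zero , Vec.here)) (const (s≤s z≤n))
0<size⇔Nonempty (false Vec.∷ C) = nonempty-outside ⇔-∘ 0<size⇔Nonempty C

1<size⇔AtLeastTwo : (C : Subset n) → 1 < size C ⇔ AtLeastTwo C
1<size⇔AtLeastTwo Vec.[] = mk⇔ (λ ()) (λ ())
1<size⇔AtLeastTwo (true Vec.∷ C) = mk⇔
  (λ { (s≤s 0<s) → let (i , i∈) = to (0<size⇔Nonempty C) 0<s in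
                   zero , suc i , Vec.here , Vec.there i∈ , λ () })
  (λ two → s≤s (from (0<size⇔Nonempty C) (tail-point two)))
  where
  tail-point : AtLeastTwo (true Vec.∷ C) → Nonempty C
  tail-point (suc x , _ , x∈ , _) = x , drop-there x∈
  tail-point (zero , suc y , _ , y∈ , _) = y , drop-there y∈
  tail-point (zero , zero , _ , _ , x≢y) = contradiction refl x≢y
1<size⇔AtLeastTwo (false Vec.∷ C) = mk⇔
  (λ 1<s → let (x , y , x∈ , y∈ , x≢y) = to (1<size⇔AtLeastTwo C) 1<s in
           suc x , suc y , Vec.there x∈ , Vec.there y∈ , x≢y ∘ suc-injective)
  (λ { (suc x , suc y , x∈ , y∈ , x≢y) →
         from (1<size⇔AtLeastTwo C) (x , y , drop-there x∈ , drop-there y∈ , x≢y ∘ cong suc) })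

T-2≤ᵇsize : (C : Subset n) → T (2 Data.Nat.≤ᵇ size C) ⇔ AtLeastTwo C
T-2≤ᵇsize C = 1<size⇔AtLeastTwo C ⇔-∘ mk⇔ (≤ᵇ⇒≤ 2 (size C)) ≤⇒≤ᵇ

ExactlyTwo : (A → Set) → Set
ExactlyTwo {A = A} P = ∃₂ λ (a b : A) → a ≢ b × (∀ {z} → P z ⇔ (z ≡ a ⊎ z ≡ b))

ExactlyTwo-cong : {P Q : A → Set} → (∀ {z} → P z ⇔ Q z) → ExactlyTwo P ⇔ ExactlyTwo Q
ExactlyTwo-cong P⇔Q = mk⇔
  (λ (a , b , a≢b , P⇔) → a , b , a≢b , P⇔ ⇔-∘ ⇔-sym P⇔Q)
  (λ (a , b , a≢b , Q⇔) → a , b , a≢b , Q⇔ ⇔-∘ P⇔Q)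

pigeonhole : ∀ {a b x y z : A} → x ≢ y → x ≢ z → y ≢ z →
             x ≡ a ⊎ x ≡ b → y ≡ a ⊎ y ≡ b → z ≡ a ⊎ z ≡ b → ⊥
pigeonhole x≢y _ _ (inj₁ refl) (inj₁ refl) _ = x≢y refl
pigeonhole x≢y _ _ (inj₂ refl) (inj₂ refl) _ = x≢y refl
pigeonhole _ x≢z _ (inj₁ refl) _ (inj₁ refl) = x≢z refl
pigeonhole _ x≢z _ (inj₂ refl) _ (inj₂ refl) = x≢z refl
pigeonhole _ _ y≢z _ (inj₁ refl) (inj₁ refl) = y≢z refl
pigeonhole _ _ y≢z _ (inj₂ refl) (inj₂ refl) = y≢z refl

length≡2⇔ExactlyTwo : Unique xs → length xs ≡ 2 ⇔ ExactlyTwo (_∈ xs)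
length≡2⇔ExactlyTwo u = mk⇔ (length≡2⇒ u) (⇒length≡2 u)
  where
  length≡2⇒ : Unique xs → length xs ≡ 2 → ExactlyTwo (_∈ xs)
  length≡2⇒ {xs = a ∷ b ∷ []} ((a≢b ∷ []) ∷ _) _ = a , b , a≢b , mk⇔
    (λ { (here e) → inj₁ e ; (there (here e)) → inj₂ e ; (there (there ())) })
    [ here , there ∘ here ]
  ⇒length≡2 : Unique xs → ExactlyTwo (_∈ xs) → length xs ≡ 2
  ⇒length≡2 {xs = []} _ (_ , _ , _ , ∈⇔) with () ← from ∈⇔ (inj₁ refl)
  ⇒length≡2 {xs = x ∷ []} _ (a , b , a≢b , ∈⇔)
    with here refl ← from ∈⇔ (inj₁ refl) | here refl ← from ∈⇔ (inj₂ refl) = ⊥-elim (a≢b refl)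
  ⇒length≡2 {xs = x ∷ y ∷ []} _ _ = refl
  ⇒length≡2 {xs = x ∷ y ∷ z ∷ _} ((x≢y ∷ x≢z ∷ _) ∷ (y≢z ∷ _) ∷ _) (_ , _ , _ , ∈⇔) =
    ⊥-elim (pigeonhole x≢y x≢z y≢z (to ∈⇔ (here refl)) (to ∈⇔ (there (here refl)))
                                    (to ∈⇔ (there (there (here refl)))))

-- members F is select (allVecs n) (mask F) by definition.
select : (xs : List A) → Vec Bool (length xs) → List A
select xs bs = List.map proj₂
  (filter (λ p → proj₁ p ≟ᵇ true) (Vec.toList (Vec.zip bs (Vec.fromList xs))))

∈-select-∷ : ∀ b {bs : Vec Bool (length xs)} →
             y ∈ select (x ∷ xs) (b Vec.∷ bs) ⇔ ((T b × y ≡ x) ⊎ y ∈ select xs bs)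
∈-select-∷ true = mk⇔ (λ { (here e) → inj₁ (_ , e) ; (there y∈) → inj₂ y∈ })
                      [ here ∘ proj₂ , there ]
∈-select-∷ false = mk⇔ inj₂ [ (λ ()) ∘ proj₁ , id ]

∈-select⁻ : ∀ {bs} → y ∈ select xs bs → y ∈ xs
∈-select⁻ {xs = []} {Vec.[]} ()
∈-select⁻ {xs = x ∷ xs} {b Vec.∷ bs} y∈ with to (∈-select-∷ b) y∈
... | inj₁ (_ , e) = here e
... | inj₂ y∈′ = there (∈-select⁻ {xs = xs} {bs} y∈′)

select⁺ : ∀ {bs} → Unique xs → Unique (select xs bs)
select⁺ {xs = []} {Vec.[]} _ = []
select⁺ {xs = x ∷ xs} {true Vec.∷ bs} (x∉ ∷ u) =
  ¬Any⇒All¬ _ (All¬⇒¬Any x∉ ∘ ∈-select⁻ {xs = xs} {bs}) ∷ select⁺ {bs = bs} u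
select⁺ {xs = x ∷ xs} {false Vec.∷ bs} (_ ∷ u) = select⁺ {bs = bs} u

∈-select-map : ∀ {f : A → Bool} → y ∈ select xs (Vec.map f (Vec.fromList xs)) ⇔ (y ∈ xs × T (f y))
∈-select-map {xs = []} = mk⇔ (λ ()) (λ ())
∈-select-map {xs = x ∷ xs} {f = f} = mk⇔
  (λ y∈ → [ (λ { (fx , refl) → here refl , fx })
            , (λ y∈′ → let (y∈xs , fy) = to ∈-select-map y∈′ in there y∈xs , fy) ]
            (to (∈-select-∷ (f x)) y∈))
  (λ { (here refl , fy) → from (∈-select-∷ (f x)) (inj₁ (fy , refl))
     ; (there y∈xs , fy) → from (∈-select-∷ (f x)) (inj₂ (from ∈-select-map (y∈xs , fy))) })

select-injective : ∀ {bs cs} → Unique xs → (∀ {y} → y ∈ select xs bs ⇔ y ∈ select xs cs) → bs ≡ cs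
select-injective {xs = []} {Vec.[]} {Vec.[]} _ _ = refl
select-injective {xs = x ∷ xs} {b Vec.∷ bs} {c Vec.∷ cs} (x∉ ∷ u) same =
  cong₂ Vec._∷_ (⇔→≡ (T-≡ ⇔-∘ (head-kept⇔ ⇔-∘ ⇔-sym T-≡)))
                (select-injective u (mk⇔ (tail-kept b c bs cs (to same)) (tail-kept c b cs bs (from same))))
  where
  x∉xs : x ∉ xs
  x∉xs = All¬⇒¬Any x∉
  module _ (b′ c′ : Bool) (bs′ cs′ : Vec Bool (length xs))
           (sub : ∀ {y} → y ∈ select (x ∷ xs) (b′ Vec.∷ bs′) → y ∈ select (x ∷ xs) (c′ Vec.∷ cs′)) where
    head-kept : T b′ → T c′
    head-kept tb with to (∈-select-∷ c′) (sub (from (∈-select-∷ b′) (inj₁ (tb , refl))))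
    ... | inj₁ (tc , _) = tc
    ... | inj₂ x∈ = contradiction (∈-select⁻ {xs = xs} {cs′} x∈) x∉xs
    tail-kept : y ∈ select xs bs′ → y ∈ select xs cs′
    tail-kept y∈ with to (∈-select-∷ c′) (sub (from (∈-select-∷ b′) (inj₂ y∈)))
    ... | inj₁ (_ , refl) = contradiction (∈-select⁻ {xs = xs} {bs′} y∈) x∉xs
    ... | inj₂ y∈′ = y∈′
  head-kept⇔ : T b ⇔ T c
  head-kept⇔ = mk⇔ (head-kept b c bs cs (to same)) (head-kept c b cs bs (from same))

private
  extensions : Vec Bool n → List (Vec Bool (suc n))
  extensions v = (false Vec.∷ v) ∷ (true Vec.∷ v) ∷ []

∈-concatMap-extensions⁺ : ∀ b {v : Vec Bool n} {vs} → v ∈ vs → (b Vec.∷ v) ∈ List.concatMap extensions vs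
∈-concatMap-extensions⁺ false (here refl) = here refl
∈-concatMap-extensions⁺ true (here refl) = there (here refl)
∈-concatMap-extensions⁺ b (there v∈) = there (there (∈-concatMap-extensions⁺ b v∈))

∈-concatMap-extensions⁻ : ∀ {b} {v : Vec Bool n} {vs} → (b Vec.∷ v) ∈ List.concatMap extensions vs → v ∈ vs
∈-concatMap-extensions⁻ {vs = w ∷ vs} (here refl) = here refl
∈-concatMap-extensions⁻ {vs = w ∷ vs} (there (here refl)) = here refl
∈-concatMap-extensions⁻ {vs = w ∷ vs} (there (there v∈)) = there (∈-concatMap-extensions⁻ v∈)

concatMap-extensions⁺ : {vs : List (Vec Bool n)} → Unique vs → Unique (List.concatMap extensions vs)
concatMap-extensions⁺ {vs = []} [] = []
concatMap-extensions⁺ {vs = v ∷ vs} (v∉ ∷ u) =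
  ((λ ()) ∷ ¬Any⇒All¬ _ (fresh ∘ ∈-concatMap-extensions⁻)) ∷ ¬Any⇒All¬ _ (fresh ∘ ∈-concatMap-extensions⁻)
  ∷ concatMap-extensions⁺ u
  where
  fresh : v ∉ vs
  fresh = All¬⇒¬Any v∉

allVecs-complete : (v : Vec Bool n) → v ∈ allVecs n
allVecs-complete Vec.[] = here refl
allVecs-complete (b Vec.∷ v) = ∈-concatMap-extensions⁺ b (allVecs-complete v)

allVecs-unique : ∀ n → Unique (allVecs n)
allVecs-unique zero = [] ∷ []
allVecs-unique (suc n) = concatMap-extensions⁺ (allVecs-unique n)

members-unique : (F : Family n) → Unique (members F)
members-unique F = select⁺ {bs = mask F} (allVecs-unique _)

∈-mkFamily : ∀ {f : Subset n → Bool} → C ∈ members (mkFamily f) ⇔ T (f C)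
∈-mkFamily {n = n} {f = f} = mk⇔ (proj₂ ∘ to (∈-select-map {xs = allVecs n} {f = f}))
                                 (λ fC → from (∈-select-map {xs = allVecs n}) (allVecs-complete _ , fC))

members-ext : (∀ {C} → C ∈ members F ⇔ C ∈ members G) → F ≡ G
members-ext same = cong fam (select-injective (allVecs-unique _) same)

T-∈F : ∀ F → T (C ∈F F) ⇔ C ∈ members {n} F
T-∈F F = mk⇔
  (λ t → let (D , D∈ , C=D) = to T-anyL t in subst (_∈ members F) (sym (to T-== C=D)) D∈)
  (λ C∈ → from T-anyL (_ , C∈ , from T-== refl))

-- Hierarchies

record IsHierarchy (M : Subset n → Set) : Set where
  field
    nonempty : ∀ {C} → M C → Nonempty C
    ⊤∈ : M ⊤
    ⁅⁆∈ : ∀ i → M ⁅ i ⁆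
    nested : ∀ {C D} → M C → M D → C ⊆ D ⊎ D ⊆ C ⊎ Disjoint C D

record Split (M : Subset n → Set) (C : Subset n) : Set where
  constructor mkSplit
  field
    {left right} : Subset n
    left∈ : M left
    right∈ : M right
    parts-disjoint : Disjoint left right
    parts-∪ : left ∪ right ≡ C

record IsChild (M : Subset n → Set) (C D : Subset n) : Set where
  constructor child
  field
    member : M D
    ⊂parent : D ⊂ C
    maximal : ∀ {E} → M E → D ⊂ E → ¬ E ⊂ C

record IsBinaryHierarchy (M : Subset n → Set) : Set where
  field
    isHierarchy : IsHierarchy M
    split : ∀ {C} → M C → AtLeastTwo C → Split M C
  open IsHierarchy isHierarchy public

Split-swap : ∀ {M} → Split M C → Split {n} M C
Split-swap (mkSplit A∈ B∈ A∩B=∅ A∪B≡C) = mkSplit B∈ A∈ (Disjoint-sym A∩B=∅) (trans (∪-comm _ _) A∪B≡C)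

Split-resp : ∀ {M N : Subset n → Set} → (∀ {C} → M C → N C) → Split M C → Split N C
Split-resp M⇒N (mkSplit A∈ B∈ A∩B=∅ A∪B≡C) = mkSplit (M⇒N A∈) (M⇒N B∈) A∩B=∅ A∪B≡C

IsBinaryHierarchy-resp : ∀ {M N : Subset n → Set} → (∀ {C} → M C ⇔ N C) →
                         IsBinaryHierarchy M → IsBinaryHierarchy N
IsBinaryHierarchy-resp M⇔N B = record
  { isHierarchy = record
    { nonempty = nonempty ∘ from M⇔N
    ; ⊤∈ = to M⇔N ⊤∈
    ; ⁅⁆∈ = to M⇔N ∘ ⁅⁆∈
    ; nested = λ C∈ D∈ → nested (from M⇔N C∈) (from M⇔N D∈)
    }
  ; split = λ C∈ two → Split-resp (to M⇔N) (split (from M⇔N C∈) two)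
  }
  where open IsBinaryHierarchy B

below-child : ∀ {E} {xs : List (Subset n)} → E ∈ xs → E ⊂ C → ∃[ D ] IsChild (_∈ xs) C D × E ⊆ D
below-child {C = C} {E} {xs} E∈ E⊂C = best , child best∈ best⊂C maximal , E⊆best
  where
  Between : Subset _ → Set
  Between D = E ⊆ D × D ⊂ C
  between? : ∀ D → Dec (Between D)
  between? D = E ⊆? D ×-dec D ⊂? C
  candidates : List (Subset _)
  candidates = filter between? xs
  -- A largest member between E and C is a child of C.
  best : Subset _
  best = argmax ∣_∣ E candidates
  best-props : best ∈ xs × Between best
  best-props = argmax-all ∣_∣ {P = λ D → D ∈ xs × Between D} (E∈ , id , E⊂C)
                          (All.tabulate (∈-filter⁻ between?))
  best∈ : best ∈ xs
  best∈ = proj₁ best-props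
  E⊆best : E ⊆ best
  E⊆best = proj₁ (proj₂ best-props)
  best⊂C : best ⊂ C
  best⊂C = proj₂ (proj₂ best-props)
  maximal : ∀ {D} → D ∈ xs → best ⊂ D → ¬ D ⊂ C
  maximal D∈ best⊂D D⊂C = <⇒≱ (p⊂q⇒∣p∣<∣q∣ best⊂D)
    (All.lookup (f[xs]≤f[argmax] E candidates) (∈-filter⁺ between? D∈ (proj₁ best⊂D ∘ E⊆best , D⊂C)))

module HierarchyProperties {M : Subset n → Set} (H : IsHierarchy M) where
  open IsHierarchy H

  children-disjoint : ∀ {A B} → IsChild M C A → IsChild M C B → A ≢ B → Disjoint A B
  children-disjoint (child A∈ A⊂C A-max) (child B∈ B⊂C B-max) A≢B with nested A∈ B∈
  ... | inj₁ A⊆B = ⊥-elim (A-max B∈ (⊆×≢⇒⊂ A⊆B A≢B) B⊂C)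
  ... | inj₂ (inj₁ B⊆A) = ⊥-elim (B-max A∈ (⊆×≢⇒⊂ B⊆A (A≢B ∘ sym)) A⊂C)
  ... | inj₂ (inj₂ A∩B=∅) = A∩B=∅

  below-split : ∀ {E} (s : Split M C) → M E → E ⊂ C → E ⊆ Split.left s ⊎ E ⊆ Split.right s
  below-split {E = E} (mkSplit {A} {B} A∈ B∈ A∩B=∅ refl) E∈ (E⊆A∪B , x , x∈A∪B , x∉E)
    with nested E∈ A∈
  ... | inj₁ E⊆A = inj₁ E⊆A
  ... | inj₂ (inj₂ E∩A=∅) = inj₂ (⊆-∪-disjointˡ E⊆A∪B E∩A=∅)
  ... | inj₂ (inj₁ A⊆E) with nested E∈ B∈
  ...   | inj₁ E⊆B = inj₂ E⊆B
  ...   | inj₂ (inj₂ E∩B=∅) = inj₁ (⊆-∪-disjointʳ E⊆A∪B E∩B=∅)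
  ...   | inj₂ (inj₁ B⊆E) = ⊥-elim (x∉E (∪-least A⊆E B⊆E x∈A∪B))

  left⊂ : (s : Split M C) → Split.left s ⊂ C
  left⊂ (mkSplit {A} {B} _ B∈ A∩B=∅ refl) =
    let (b , b∈B) = nonempty B∈ in p⊆p∪q B , b , q⊆p∪q A B b∈B , Disjoint-sym A∩B=∅ b∈B

  split-left-child : (s : Split M C) → IsChild M C (Split.left s)
  split-left-child s@(mkSplit {A} {B} A∈ B∈ A∩B=∅ refl) = child A∈ (left⊂ s) maximal
    where
    maximal : ∀ {E} → M E → A ⊂ E → ¬ E ⊂ A ∪ B
    maximal E∈ (A⊆E , x , x∈E , x∉A) E⊂A∪B with below-split s E∈ E⊂A∪B
    ... | inj₁ E⊆A = x∉A (E⊆A x∈E)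
    ... | inj₂ E⊆B = let (a , a∈A) = nonempty A∈ in A∩B=∅ a∈A (E⊆B (A⊆E a∈A))

  child-⊆⇒≡ : ∀ {A D} → IsChild M C D → M A → A ⊂ C → D ⊆ A → D ≡ A
  child-⊆⇒≡ {A = A} {D} (child _ _ D-max) A∈ A⊂C D⊆A with ≡-dec _≟ᵇ_ D A
  ... | yes D≡A = D≡A
  ... | no D≢A = ⊥-elim (D-max A∈ (⊆×≢⇒⊂ D⊆A D≢A) A⊂C)

  split⇒exactlyTwoChildren : Split M C → ExactlyTwo (IsChild M C)
  split⇒exactlyTwoChildren {C = C} s@(mkSplit {A} {B} A∈ B∈ A∩B=∅ _) =
    A , B , A≢B , mk⇔ which-child is-child
    where
    A≢B : A ≢ B
    A≢B refl = let (a , a∈A) = nonempty A∈ in A∩B=∅ a∈A a∈A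
    which-child : ∀ {D} → IsChild M C D → D ≡ A ⊎ D ≡ B
    which-child D-child@(child D∈ D⊂C _) with below-split s D∈ D⊂C
    ... | inj₁ D⊆A = inj₁ (child-⊆⇒≡ D-child A∈ (left⊂ s) D⊆A)
    ... | inj₂ D⊆B = inj₂ (child-⊆⇒≡ D-child B∈ (left⊂ (Split-swap s)) D⊆B)
    is-child : ∀ {D} → D ≡ A ⊎ D ≡ B → IsChild M C D
    is-child (inj₁ refl) = split-left-child s
    is-child (inj₂ refl) = split-left-child (Split-swap s)

exactlyTwoChildren⇔Split : ∀ {xs : List (Subset n)} → IsHierarchy (_∈ xs) → C ∈ xs → AtLeastTwo C →
                           ExactlyTwo (IsChild (_∈ xs) C) ⇔ Split (_∈ xs) C
exactlyTwoChildren⇔Split {C = C} {xs} H C∈ two = mk⇔ children⇒split split⇒exactlyTwoChildren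
  where
  open IsHierarchy H
  open HierarchyProperties H
  children⇒split : ExactlyTwo (IsChild (_∈ xs) C) → Split (_∈ xs) C
  children⇒split (A , B , A≢B , child⇔) =
    mkSplit (IsChild.member A-child) (IsChild.member B-child)
            (children-disjoint A-child B-child A≢B) (⊆-antisym A∪B⊆C C⊆A∪B)
    where
    A-child : IsChild (_∈ xs) C A
    A-child = from child⇔ (inj₁ refl)
    B-child : IsChild (_∈ xs) C B
    B-child = from child⇔ (inj₂ refl)
    A∪B⊆C : A ∪ B ⊆ C
    A∪B⊆C = ∪-least (proj₁ (IsChild.⊂parent A-child)) (proj₁ (IsChild.⊂parent B-child))
    C⊆A∪B : C ⊆ A ∪ B
    C⊆A∪B {x} x∈ with below-child (⁅⁆∈ x) (⁅⁆⊂ x∈ two)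
    ... | D , D-child , ⁅x⁆⊆D with to child⇔ D-child
    ...   | inj₁ refl = p⊆p∪q B (⁅x⁆⊆D (x∈⁅x⁆ x))
    ...   | inj₂ refl = q⊆p∪q A B (⁅x⁆⊆D (x∈⁅x⁆ x))

module _ (F : Family n) where
  private
    M : Subset n → Set
    M = _∈ members F

    isChildᵇ : Subset n → Subset n → Bool
    isChildᵇ C D = (D ⊂ᵇ C) ∧ not (anyL (λ E → (D ⊂ᵇ E) ∧ (E ⊂ᵇ C)) (members F))

  ∈-children : D ∈ children F C ⇔ IsChild M C D
  ∈-children {D = D} {C = C} = mk⇔
    (λ D∈ → let (D∈F , isChild) = ∈-filter⁻ (λ D → isChildᵇ C D ≟ᵇ true) D∈
                (D⊂C , maximal) = to T-∧ (from T-≡ isChild)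
            in child D∈F (to (T-⊂ᵇ D C) D⊂C)
                 (λ E∈ D⊂E E⊂C → to T-not maximal
                    (from T-anyL (_ , E∈ , from T-∧ (from (T-⊂ᵇ D _) D⊂E , from (T-⊂ᵇ _ C) E⊂C)))))
    (λ (child D∈F D⊂C maximal) → ∈-filter⁺ (λ D → isChildᵇ C D ≟ᵇ true) D∈F
       (to T-≡ (from T-∧ (from (T-⊂ᵇ D C) D⊂C , from T-not λ t →
          let (E , E∈ , D⊂E⊂C) = to T-anyL t
              (D⊂E , E⊂C) = to T-∧ D⊂E⊂C
          in maximal E∈ (to (T-⊂ᵇ D E) D⊂E) (to (T-⊂ᵇ E C) E⊂C)))))

  T-length-children≡2 : T ⌊ length (children F C) Data.Nat.≟ 2 ⌋ ⇔ ExactlyTwo (IsChild M C)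
  T-length-children≡2 {C = C} = ExactlyTwo-cong ∈-children
    ⇔-∘ (length≡2⇔ExactlyTwo (filter⁺ (λ D → isChildᵇ C D ≟ᵇ true) (members-unique F)) ⇔-∘ T-⌊⌋ _)

  binaryᵇ : Subset n → Bool
  binaryᵇ C = if 2 Data.Nat.≤ᵇ size C then ⌊ length (children F C) Data.Nat.≟ 2 ⌋ else true

  T-binaryᵇ : IsHierarchy M → C ∈ members F → T (binaryᵇ C) ⇔ (AtLeastTwo C → Split M C)
  T-binaryᵇ {C = C} H C∈ = mk⇔
    (λ t two → to (exactlyTwoChildren⇔Split H C∈ two)
                 (to T-length-children≡2 (to (T-if-else-true _) t (from (T-2≤ᵇsize C) two))))
    (λ h → from (T-if-else-true _) λ t →
       let two = to (T-2≤ᵇsize C) t in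
       from T-length-children≡2 (from (exactlyTwoChildren⇔Split H C∈ two) (h two)))

nestedᵇ : Subset n → Subset n → Bool
nestedᵇ C D = (C ⊆ᵇ D) ∨ (D ⊆ᵇ C) ∨ disjoint C D

T-nestedᵇ : T (nestedᵇ C D) ⇔ (C ⊆ D ⊎ D ⊆ C ⊎ Disjoint C D)
T-nestedᵇ {C = C} {D} = (T-⊆ᵇ C D ⊎-⇔ ((T-⊆ᵇ D C ⊎-⇔ T-disjoint C D) ⇔-∘ T-∨)) ⇔-∘ T-∨

isTree⇔ : ∀ F → T (isTree F) ⇔ IsBinaryHierarchy (_∈ members {n} F)
isTree⇔ F = mk⇔ isTree⁻ isTree⁺
  where
  M : Subset _ → Set
  M = _∈ members F

  allNonemptyᵇ hasTopᵇ hasSingletonsᵇ allNestedᵇ : Bool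
  allNonemptyᵇ = allL (not ∘ isEmpty) (members F)
  hasTopᵇ = full _ ∈F F
  hasSingletonsᵇ = allL (λ i → singleton i ∈F F) (allFin _)
  allNestedᵇ = allL (λ C → allL (nestedᵇ C) (members F)) (members F)

  isTree⁻ : T (isTree F) → IsBinaryHierarchy M
  isTree⁻ t with to (T-∧ {allNonemptyᵇ}) t
  ... | nonemptyᵗ , t₂ with to (T-∧ {hasTopᵇ}) t₂
  ... | topᵗ , t₃ with to (T-∧ {hasSingletonsᵇ}) t₃
  ... | singletonsᵗ , t₄ with to (T-∧ {allNestedᵇ}) t₄
  ... | nestedᵗ , binaryᵗ = record
    { isHierarchy = H
    ; split = λ C∈ → to (T-binaryᵇ F H C∈) (to (T-allL {f = binaryᵇ F}) binaryᵗ C∈)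
    }
    where
    H : IsHierarchy M
    H = record
      { nonempty = λ C∈ → to (T-not-isEmpty _) (to (T-allL {f = not ∘ isEmpty}) nonemptyᵗ C∈)
      ; ⊤∈ = to (T-∈F F) topᵗ
      ; ⁅⁆∈ = λ i → subst M (singleton≡⁅⁆ i)
                      (to (T-∈F F) (to (T-allL {f = λ i → singleton i ∈F F}) singletonsᵗ (∈-allFin i)))
      ; nested = λ {C} C∈ D∈ → to T-nestedᵇ (to (T-allL {f = nestedᵇ C})
                   (to (T-allL {f = λ C → allL (nestedᵇ C) (members F)}) nestedᵗ C∈) D∈)
      }

  isTree⁺ : IsBinaryHierarchy M → T (isTree F)
  isTree⁺ B =
    from (T-∧ {allNonemptyᵇ}) (from (T-allL {f = not ∘ isEmpty}) (from (T-not-isEmpty _) ∘ nonempty) ,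
    from (T-∧ {hasTopᵇ}) (from (T-∈F F) ⊤∈ ,
    from (T-∧ {hasSingletonsᵇ}) (from (T-allL {xs = allFin _} {f = λ i → singleton i ∈F F})
      (λ {i} _ → from (T-∈F F) (subst M (sym (singleton≡⁅⁆ i)) (⁅⁆∈ i))) ,
    from (T-∧ {allNestedᵇ}) (from (T-allL {f = λ C → allL (nestedᵇ C) (members F)})
      (λ {C} C∈ → from (T-allL {f = nestedᵇ C}) (λ D∈ → from T-nestedᵇ (nested C∈ D∈))) ,
    from (T-allL {f = binaryᵇ F}) (λ C∈ → from (T-binaryᵇ F isHierarchy C∈) (split C∈))))))
    where open IsBinaryHierarchy B

-- Pullbacks along maps of leaf sets

preimage : (Fin k → Fin m) → Subset m → Subset k
preimage f C = tabulate (λ i → lookup C (f i))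

∈-preimage : ∀ (f : Fin k → Fin m) C {x} → x ∈ₛ preimage f C ⇔ f x ∈ₛ C
∈-preimage f C = ⇔-sym ∈⇔lookup ⇔-∘ ∈-tabulate

preimage-⊆ : ∀ (f : Fin k → Fin m) → C ⊆ D → preimage f C ⊆ preimage f D
preimage-⊆ {C = C} {D} f C⊆D = from (∈-preimage f D) ∘ C⊆D ∘ to (∈-preimage f C)

preimage-disjoint : ∀ (f : Fin k → Fin m) → Disjoint C D → Disjoint (preimage f C) (preimage f D)
preimage-disjoint {C = C} {D} f C∩D=∅ x∈ y∈ = C∩D=∅ (to (∈-preimage f C) x∈) (to (∈-preimage f D) y∈)

preimage-∪ : ∀ (f : Fin k → Fin m) C D → preimage f (C ∪ D) ≡ preimage f C ∪ preimage f D
preimage-∪ f C D = ⊆-antisym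
  (x∈p∪q⁺ ∘ ⊎-map (from (∈-preimage f C)) (from (∈-preimage f D)) ∘ x∈p∪q⁻ C D ∘ to (∈-preimage f (C ∪ D)))
  (from (∈-preimage f (C ∪ D)) ∘ x∈p∪q⁺ ∘ ⊎-map (to (∈-preimage f C)) (to (∈-preimage f D))
     ∘ x∈p∪q⁻ (preimage f C) (preimage f D))

preimage-⊤ : ∀ (f : Fin k → Fin m) → preimage f ⊤ ≡ ⊤
preimage-⊤ f = ⊆-antisym (const ∈⊤) (const (from (∈-preimage f ⊤) ∈⊤))

preimage-⁅⁆ : ∀ {f : Fin k → Fin m} → Injective _≡_ _≡_ f → ∀ i → preimage f ⁅ f i ⁆ ≡ ⁅ i ⁆
preimage-⁅⁆ {f = f} f-inj i = ⊆-antisym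
  (λ x∈ → subst (_∈ₛ ⁅ i ⁆) (sym (f-inj (x∈⁅y⁆⇒x≡y (f i) (to (∈-preimage f ⁅ f i ⁆) x∈)))) (x∈⁅x⁆ i))
  (λ x∈ → from (∈-preimage f ⁅ f i ⁆) (subst (λ y → f y ∈ₛ ⁅ f i ⁆) (sym (x∈⁅y⁆⇒x≡y i x∈)) (x∈⁅x⁆ (f i))))

preimage-∘ : ∀ (f : Fin k → Fin m) (g : Fin m → Fin n) C → preimage f (preimage g C) ≡ preimage (g ∘ f) C
preimage-∘ f g C = ⊆-antisym
  (from (∈-preimage (g ∘ f) C) ∘ to (∈-preimage g C) ∘ to (∈-preimage f (preimage g C)))
  (from (∈-preimage f (preimage g C)) ∘ from (∈-preimage g C) ∘ to (∈-preimage (g ∘ f) C))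

preimage-cong : ∀ {f g : Fin k → Fin m} → f ≗ g → ∀ C → preimage f C ≡ preimage g C
preimage-cong f≗g C = tabulate-cong (cong (lookup C) ∘ f≗g)

preimage-inverse : ∀ {f : Fin k → Fin m} {g : Fin m → Fin k} → (∀ x → g (f x) ≡ x) →
                   ∀ C → preimage f (preimage g C) ≡ C
preimage-inverse {f = f} {g} g∘f≗id C =
  trans (preimage-∘ f g C) (trans (preimage-cong g∘f≗id C) (tabulate∘lookup C))

Pullback : (Fin k → Fin m) → (Subset m → Set) → Subset k → Set
Pullback f M D = ∃[ C ] M C × Nonempty (preimage f C) × preimage f C ≡ D

-- restrict k≤m is pullback (λ i → inject≤ i k≤m) by definition.
pullback : (Fin k → Fin m) → Family m → Family k
pullback f F =
  mkFamily (λ D → anyL (λ C → not (isEmpty (preimage f C)) ∧ (preimage f C == D)) (members F))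

∈-pullback : ∀ (f : Fin k → Fin m) F {D} → D ∈ members (pullback f F) ⇔ Pullback f (_∈ members F) D
∈-pullback f F = mk⇔
  (λ D∈ → let (C , C∈ , t) = to T-anyL (to ∈-mkFamily D∈)
              (ne , eq) = to T-∧ t
          in C , C∈ , to (T-not-isEmpty (preimage f C)) ne , to T-== eq)
  (λ (C , C∈ , ne , eq) → from ∈-mkFamily
     (from T-anyL (C , C∈ , from T-∧ (from (T-not-isEmpty (preimage f C)) ne , from T-== eq))))

-- The point x₀ makes the pullback of ⊤ nonempty.
module _ {M : Subset m → Set} (B : IsBinaryHierarchy M) {f : Fin k → Fin m}
         (x₀ : Fin k) (f-inj : Injective _≡_ _≡_ f) where
  open IsBinaryHierarchy B
  open HierarchyProperties isHierarchy

  private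
    split-preimage : ∀ {C} → Acc _<_ ∣ C ∣ → M C → AtLeastTwo (preimage f C) →
                     Split (Pullback f M) (preimage f C)
    split-preimage {C} (acc smaller) C∈ two@(x , y , x∈ , y∈ , x≢y) =
      split-parts (split C∈ (f x , f y , to (∈-preimage f C) x∈ , to (∈-preimage f C) y∈ , x≢y ∘ f-inj))
      where
      descend : ∀ {D} → M D → D ⊂ C → preimage f D ≡ preimage f C → Split (Pullback f M) (preimage f C)
      descend D∈ D⊂C eq = subst (Split (Pullback f M)) eq
        (split-preimage (smaller (p⊂q⇒∣p∣<∣q∣ D⊂C)) D∈ (subst AtLeastTwo (sym eq) two))
      split-parts : Split M C → Split (Pullback f M) (preimage f C)
      split-parts s@(mkSplit {A} {B} A∈ B∈ A∩B=∅ A∪B≡C) =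
        choose (nonempty? (preimage f A)) (nonempty? (preimage f B))
        where
        parts : preimage f A ∪ preimage f B ≡ preimage f C
        parts = trans (sym (preimage-∪ f A B)) (cong (preimage f) A∪B≡C)
        choose : Dec (Nonempty (preimage f A)) → Dec (Nonempty (preimage f B)) →
                 Split (Pullback f M) (preimage f C)
        choose (yes neA) (yes neB) =
          mkSplit (A , A∈ , neA , refl) (B , B∈ , neB , refl) (preimage-disjoint f A∩B=∅) parts
        choose (no ¬neA) _ = descend B∈ (left⊂ (Split-swap s)) (trans (sym (∪-emptyˡ ¬neA)) parts)
        choose (yes _) (no ¬neB) = descend A∈ (left⊂ s) (trans (sym (∪-emptyʳ ¬neB)) parts)

  pullback-binary : IsBinaryHierarchy (Pullback f M)
  pullback-binary = record
    { isHierarchy = record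
      { nonempty = λ { (_ , _ , ne , refl) → ne }
      ; ⊤∈ = ⊤ , ⊤∈ , (x₀ , from (∈-preimage f ⊤) ∈⊤) , preimage-⊤ f
      ; ⁅⁆∈ = λ i → ⁅ f i ⁆ , ⁅⁆∈ (f i) , (i , from (∈-preimage f ⁅ f i ⁆) (x∈⁅x⁆ (f i)))
                  , preimage-⁅⁆ f-inj i
      ; nested = λ { (C , C∈ , _ , refl) (D , D∈ , _ , refl) →
                     ⊎-map (preimage-⊆ f) (⊎-map (preimage-⊆ f) (preimage-disjoint f)) (nested C∈ D∈) }
      }
    ; split = λ { (C , C∈ , _ , refl) → split-preimage (<-wellFounded ∣ C ∣) C∈ }
    }

NonemptyMembers : Family n → Set
NonemptyMembers F = ∀ {C} → C ∈ members F → Nonempty C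

tree-nonempty : T (isTree F) → NonemptyMembers F
tree-nonempty {F = F} = IsBinaryHierarchy.nonempty ∘ to (isTree⇔ F)

pullback-nonempty : ∀ (f : Fin k → Fin m) → NonemptyMembers (pullback f F)
pullback-nonempty {F = F} f C∈ = let (_ , _ , ne , C≡) = to (∈-pullback f F) C∈ in subst Nonempty C≡ ne

pullback-tree : ∀ {f : Fin k → Fin m} → Fin k → Injective _≡_ _≡_ f →
                T (isTree F) → T (isTree (pullback f F))
pullback-tree {F = F} {f = f} x₀ f-inj tF = from (isTree⇔ (pullback f F))
  (IsBinaryHierarchy-resp (⇔-sym (∈-pullback f F)) (pullback-binary (to (isTree⇔ F) tF) x₀ f-inj))

pullback-∘ : ∀ (f : Fin k → Fin m) (g : Fin m → Fin n) F → pullback f (pullback g F) ≡ pullback (g ∘ f) F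
pullback-∘ f g F = members-ext (mk⇔ composite⁺ composite⁻)
  where
  composite⁺ : ∀ {D} → D ∈ members (pullback f (pullback g F)) → D ∈ members (pullback (g ∘ f) F)
  composite⁺ D∈ with to (∈-pullback f (pullback g F)) D∈
  ... | C′ , C′∈ , ne , refl with to (∈-pullback g F) C′∈
  ...   | C , C∈ , _ , refl =
    from (∈-pullback (g ∘ f) F) (C , C∈ , subst Nonempty (preimage-∘ f g C) ne , sym (preimage-∘ f g C))
  composite⁻ : ∀ {D} → D ∈ members (pullback (g ∘ f) F) → D ∈ members (pullback f (pullback g F))
  composite⁻ D∈ with to (∈-pullback (g ∘ f) F) D∈
  ... | C , C∈ , (x , x∈) , refl = from (∈-pullback f (pullback g F))
    ( preimage g C
    , from (∈-pullback g F) (C , C∈ , (f x , from (∈-preimage g C) (to (∈-preimage (g ∘ f) C) x∈)) , refl)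
    , subst Nonempty (sym (preimage-∘ f g C)) (x , x∈)
    , preimage-∘ f g C )

pullback-cong : ∀ {f g : Fin k → Fin m} → f ≗ g → pullback f F ≡ pullback g F
pullback-cong {F = F} f≗g = members-ext (mk⇔ (transport f≗g) (transport (sym ∘ f≗g)))
  where
  transport : ∀ {f g : Fin _ → Fin _} {D} → f ≗ g → D ∈ members (pullback f F) → D ∈ members (pullback g F)
  transport {f} {g} f≗g D∈ with to (∈-pullback f F) D∈
  ... | C , C∈ , ne , refl =
    from (∈-pullback g F) (C , C∈ , subst Nonempty (preimage-cong f≗g C) ne , sym (preimage-cong f≗g C))

∈-relabel : ∀ (σ : Permutation′ n) F {D} → D ∈ members (relabel σ F) ⇔ preimage (σ ⟨$⟩ʳ_) D ∈ members F
∈-relabel σ F = T-∈F F ⇔-∘ ∈-mkFamily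

preimage-ʳˡ : ∀ (σ : Permutation′ n) C → preimage (σ ⟨$⟩ʳ_) (preimage (σ ⟨$⟩ˡ_) C) ≡ C
preimage-ʳˡ σ = preimage-inverse {f = σ ⟨$⟩ʳ_} {g = σ ⟨$⟩ˡ_} (λ _ → inverseˡ σ)

preimage-ˡʳ : ∀ (σ : Permutation′ n) C → preimage (σ ⟨$⟩ˡ_) (preimage (σ ⟨$⟩ʳ_) C) ≡ C
preimage-ˡʳ σ = preimage-inverse {f = σ ⟨$⟩ˡ_} {g = σ ⟨$⟩ʳ_} (λ _ → inverseʳ σ)

relabel-inverse : ∀ (σ : Permutation′ n) F → relabel (flip σ) (relabel σ F) ≡ F
relabel-inverse σ F = members-ext λ {D} →
  mk⇔ (subst (_∈ members F) (preimage-ʳˡ σ D)) (subst (_∈ members F) (sym (preimage-ʳˡ σ D)))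
  ⇔-∘ (∈-relabel σ F ⇔-∘ ∈-relabel (flip σ) (relabel σ F))

relabel-cancel : ∀ (σ : Permutation′ n) → relabel σ F ≡ relabel σ G ⇔ F ≡ G
relabel-cancel {F = F} {G} σ = mk⇔
  (λ eq → trans (sym (relabel-inverse σ F)) (trans (cong (relabel (flip σ)) eq) (relabel-inverse σ G)))
  (cong (relabel σ))

relabel≡pullback : ∀ (σ : Permutation′ n) → NonemptyMembers F → relabel σ F ≡ pullback (σ ⟨$⟩ˡ_) F
relabel≡pullback {F = F} σ nonempty = members-ext (mk⇔ relabel⁺ relabel⁻)
  where
  relabel⁺ : ∀ {D} → D ∈ members (relabel σ F) → D ∈ members (pullback (σ ⟨$⟩ˡ_) F)
  relabel⁺ {D} D∈ =
    let C∈ = to (∈-relabel σ F) D∈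
        (c , c∈) = nonempty C∈
        C↦D = preimage-ˡʳ σ D
    in from (∈-pullback (σ ⟨$⟩ˡ_) F) (_ , C∈ , subst Nonempty (sym C↦D) (_ , to (∈-preimage _ D) c∈) , C↦D)
  relabel⁻ : ∀ {D} → D ∈ members (pullback (σ ⟨$⟩ˡ_) F) → D ∈ members (relabel σ F)
  relabel⁻ D∈ with to (∈-pullback (σ ⟨$⟩ˡ_) F) D∈
  ... | C , C∈ , _ , refl =
    from (∈-relabel σ F) (subst (_∈ members F) (sym (preimage-ʳˡ σ C)) C∈)

relabel-tree : ∀ (σ : Permutation′ n) → T (isTree F) → T (isTree (relabel σ F))
relabel-tree {F = F} σ tF = subst (T ∘ isTree) (sym (relabel≡pullback {F = F} σ F∌∅))
  (pullback-tree {F = F} (proj₁ (F∌∅ (IsBinaryHierarchy.⊤∈ (to (isTree⇔ F) tF)))) ⟨$⟩ˡ-injective tF)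
  where
  F∌∅ : NonemptyMembers F
  F∌∅ = tree-nonempty {F = F} tF
  ⟨$⟩ˡ-injective : Injective _≡_ _≡_ (σ ⟨$⟩ˡ_)
  ⟨$⟩ˡ-injective {x} {y} eq = trans (sym (inverseʳ σ)) (trans (cong (σ ⟨$⟩ʳ_) eq) (inverseʳ σ))

restrict-tree : (k≤m : k ≤ m) → 0 < k → T (isTree S) → T (isTree (restrict k≤m S))
restrict-tree {S = S} k≤m 0<k = pullback-tree {F = S} (fromℕ< 0<k) (inject≤-injective k≤m k≤m _ _)

restrict-restrict : (n≤k : n ≤ k) (k≤m : k ≤ m) (n≤m : n ≤ m) →
                    restrict n≤k (restrict k≤m S) ≡ restrict n≤m S
restrict-restrict {S = S} n≤k k≤m n≤m =
  trans (pullback-∘ (λ i → inject≤ i n≤k) (λ i → inject≤ i k≤m) S)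
        (pullback-cong {F = S} (λ i → inject≤-idempotent i n≤k k≤m n≤m))

module _ (k≤m : k ≤ m) where
  private
    ι : Fin k → Fin m
    ι i = inject≤ i k≤m

    extendFun′ : (Fin k → Fin k) → (i : Fin m) → Dec (toℕ i < k) → Fin m
    extendFun′ g i (yes i<k) = ι (g (fromℕ< i<k))
    extendFun′ g i (no _) = i

    extendFun : (Fin k → Fin k) → Fin m → Fin m
    extendFun g i = extendFun′ g i (toℕ i <? k)

    extendFun-ι : ∀ g j → extendFun g (ι j) ≡ ι (g j)
    extendFun-ι g j with toℕ (ι j) <? k
    ... | yes ιj<k = cong (ι ∘ g) (toℕ-injective (trans (toℕ-fromℕ< ιj<k) (toℕ-inject≤ j k≤m)))
    ... | no ιj≮k = contradiction (subst (_< k) (sym (toℕ-inject≤ j k≤m)) (toℕ<n j)) ιj≮k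

    extendFun-inverse : ∀ {g h} → (∀ j → g (h j) ≡ j) → ∀ i → extendFun g (extendFun h i) ≡ i
    extendFun-inverse {g} {h} g∘h≗id i with toℕ i <? k
    ... | yes i<k = trans (extendFun-ι g (h (fromℕ< i<k)))
      (trans (cong ι (g∘h≗id _)) (toℕ-injective (trans (toℕ-inject≤ _ k≤m) (toℕ-fromℕ< i<k))))
    ... | no i≮k with toℕ i <? k
    ...   | yes i<k = contradiction i<k i≮k
    ...   | no _ = refl

  extend : Permutation′ k → Permutation′ m
  extend σ = permutation (extendFun (σ ⟨$⟩ʳ_)) (extendFun (σ ⟨$⟩ˡ_))
    (extendFun-inverse (λ _ → inverseʳ σ)) (extendFun-inverse (λ _ → inverseˡ σ))

  restrict-relabel : ∀ (σ : Permutation′ k) → T (isTree S) →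
                     restrict k≤m (relabel (extend σ) S) ≡ relabel σ (restrict k≤m S)
  restrict-relabel {S = S} σ tS = begin
    pullback ι (relabel (extend σ) S)
      ≡⟨ cong (pullback ι) (relabel≡pullback {F = S} (extend σ) (tree-nonempty {F = S} tS)) ⟩
    pullback ι (pullback (extend σ ⟨$⟩ˡ_) S)
      ≡⟨ pullback-∘ ι (extend σ ⟨$⟩ˡ_) S ⟩
    pullback ((extend σ ⟨$⟩ˡ_) ∘ ι) S
      ≡⟨ pullback-cong {F = S} (extendFun-ι (σ ⟨$⟩ˡ_)) ⟩
    pullback (ι ∘ (σ ⟨$⟩ˡ_)) S
      ≡⟨ pullback-∘ (σ ⟨$⟩ˡ_) ι S ⟨
    pullback (σ ⟨$⟩ˡ_) (pullback ι S)
      ≡⟨ relabel≡pullback {F = pullback ι S} σ (pullback-nonempty {F = S} ι) ⟨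
    relabel σ (restrict k≤m S) ∎
    where open ≡-Reasoning

-- Sums

𝟙[_] : Dec A → ℚ
𝟙[ a? ] = if does a? then 1ℚ else 0ℚ

𝟙-cong : ∀ {B : Set} → A ⇔ B → (a? : Dec A) (b? : Dec B) → 𝟙[ a? ] ≡ 𝟙[ b? ]
𝟙-cong A⇔B a? b? = cong (if_then 1ℚ else 0ℚ) (does-⇔ A⇔B a? b?)

-- Opaque, so that unification sees the list and the summand of a sum
-- rather than an unfolded foldr.
opaque
  ∑ : List A → (A → ℚ) → ℚ
  ∑ xs f = List.foldr (λ x s → f x + s) 0ℚ xs

opaque
  unfolding ∑

  sumOver≡∑ : ∀ (xs : List (Family n)) p → sumOver xs p ≡ ∑ xs p
  sumOver≡∑ xs p = refl

  ∑-cong : ∀ {f g : A → ℚ} → (∀ {x} → x ∈ xs → f x ≡ g x) → ∑ xs f ≡ ∑ xs g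
  ∑-cong {xs = []} _ = refl
  ∑-cong {xs = x ∷ xs} f≗g = cong₂ _+_ (f≗g (here refl)) (∑-cong (f≗g ∘ there))

  ∑-+ : ∀ (f g : A → ℚ) xs → ∑ xs (λ x → f x + g x) ≡ ∑ xs f + ∑ xs g
  ∑-+ f g [] = sym (+-identityˡ 0ℚ)
  ∑-+ f g (x ∷ xs) = trans (cong (f x + g x +_) (∑-+ f g xs)) (interchange (f x) (g x) (∑ xs f) (∑ xs g))

  ∑-0 : ∀ (xs : List A) → ∑ xs (const 0ℚ) ≡ 0ℚ
  ∑-0 [] = refl
  ∑-0 (x ∷ xs) = trans (+-identityˡ _) (∑-0 xs)

  ∑-comm : ∀ {B : Set} (xs : List A) (ys : List B) (g : A → B → ℚ) →
           ∑ xs (λ x → ∑ ys (g x)) ≡ ∑ ys (λ y → ∑ xs (λ x → g x y))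
  ∑-comm [] ys g = sym (∑-0 ys)
  ∑-comm (x ∷ xs) ys g =
    trans (cong (∑ ys (g x) +_) (∑-comm xs ys g)) (sym (∑-+ (g x) (λ y → ∑ xs (λ x → g x y)) ys))

  ∑-*ˡ : ∀ (c : ℚ) (f : A → ℚ) xs → ∑ xs (λ x → c * f x) ≡ c * ∑ xs f
  ∑-*ˡ c f [] = sym (*-zeroʳ c)
  ∑-*ˡ c f (x ∷ xs) = trans (cong (c * f x +_) (∑-*ˡ c f xs)) (sym (*-distribˡ-+ c (f x) (∑ xs f)))

  ∑-filter : ∀ {P : A → Set} (P? : ∀ x → Dec (P x)) xs (f : A → ℚ) →
             ∑ (filter P? xs) f ≡ ∑ xs (λ x → 𝟙[ P? x ] * f x)
  ∑-filter P? [] f = refl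
  ∑-filter P? (x ∷ xs) f with P? x
  ... | yes _ = cong₂ _+_ (sym (*-identityˡ (f x))) (∑-filter P? xs f)
  ... | no _ = trans (∑-filter P? xs f) (sym (trans (cong (_+ _) (*-zeroˡ (f x))) (+-identityˡ _)))

  ∑-nonneg : ∀ {f : A → ℚ} → (∀ {x} → x ∈ xs → 0ℚ ℚ.≤ f x) → 0ℚ ℚ.≤ ∑ xs f
  ∑-nonneg {xs = []} _ = ℚ-≤-refl
  ∑-nonneg {xs = x ∷ xs} 0≤f = +-mono-≤ (0≤f (here refl)) (∑-nonneg (0≤f ∘ there))

  ∑-δ-∉ : ∀ (_≟_ : DecidableEquality A) {a} (f : A → ℚ) → a ∉ xs → ∑ xs (λ x → 𝟙[ a ≟ x ] * f x) ≡ 0ℚ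
  ∑-δ-∉ {xs = []} _≟_ f _ = refl
  ∑-δ-∉ {xs = x ∷ xs} _≟_ {a} f a∉ with a ≟ x
  ... | yes a≡x = contradiction (here a≡x) a∉
  ... | no _ = trans (cong (_+ _) (*-zeroˡ (f x))) (trans (+-identityˡ _) (∑-δ-∉ _≟_ f (a∉ ∘ there)))

  ∑-δ : ∀ (_≟_ : DecidableEquality A) {a} (f : A → ℚ) → Unique xs → a ∈ xs →
        ∑ xs (λ x → 𝟙[ a ≟ x ] * f x) ≡ f a
  ∑-δ {xs = x ∷ xs} _≟_ {a} f (x∉ ∷ _) (here refl) with a ≟ a
  ... | yes _ = trans (cong₂ _+_ (*-identityˡ (f a)) (∑-δ-∉ _≟_ f (All¬⇒¬Any x∉))) (+-identityʳ (f a))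
  ... | no a≢a = contradiction refl a≢a
  ∑-δ {xs = x ∷ xs} _≟_ {a} f (x∉ ∷ u) (there a∈) with a ≟ x
  ... | yes refl = contradiction a∈ (All¬⇒¬Any x∉)
  ... | no _ = trans (cong (_+ _) (*-zeroˡ (f x))) (trans (+-identityˡ _) (∑-δ _≟_ f u a∈))

_≟ᶠ_ : DecidableEquality (Family n)
F ≟ᶠ G = map′ (cong fam) (cong mask) (≡-dec _≟ᵇ_ (mask F) (mask G))

∈-trees : ∀ F → F ∈ trees n ⇔ T (isTree F)
∈-trees F = mk⇔
  (from T-≡ ∘ proj₂ ∘ ∈-filter⁻ (λ F → isTree F ≟ᵇ true) {xs = List.map fam (allVecs _)})
  (λ tF → ∈-filter⁺ (λ F → isTree F ≟ᵇ true) (∈-map⁺ fam (allVecs-complete _)) (to T-≡ tF))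

trees-unique : ∀ n → Unique (trees n)
trees-unique n = filter⁺ (λ F → isTree F ≟ᵇ true) (map⁺ (cong mask) (allVecs-unique _))

∑-trees-δ : ∀ G (f : Family n → ℚ) → T (isTree G) → ∑ (trees n) (λ F → 𝟙[ G ≟ᶠ F ] * f F) ≡ f G
∑-trees-δ G f tG = ∑-δ _≟ᶠ_ f (trees-unique _) (from (∈-trees G) tG)

∑-trees-relabel : ∀ (σ : Permutation′ n) (h : Family n → ℚ) → ∑ (trees n) (h ∘ relabel σ) ≡ ∑ (trees n) h
∑-trees-relabel {n} σ h = begin
  ∑ TN (h ∘ relabel σ)
    ≡⟨ ∑-cong (λ {S} S∈ → ∑-trees-δ (relabel σ S) h (relabel-tree {F = S} σ (to (∈-trees S) S∈))) ⟨
  ∑ TN (λ S → ∑ TN (λ Q → 𝟙[ relabel σ S ≟ᶠ Q ] * h Q))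
    ≡⟨ ∑-comm TN TN (λ S Q → 𝟙[ relabel σ S ≟ᶠ Q ] * h Q) ⟩
  ∑ TN (λ Q → ∑ TN (λ S → 𝟙[ relabel σ S ≟ᶠ Q ] * h Q))
    ≡⟨ ∑-cong (λ {Q} _ → ∑-cong (λ {S} _ →
         cong (_* h Q) (𝟙-cong (moved S Q) (relabel σ S ≟ᶠ Q) (relabel (flip σ) Q ≟ᶠ S)))) ⟩
  ∑ TN (λ Q → ∑ TN (λ S → 𝟙[ relabel (flip σ) Q ≟ᶠ S ] * h Q))
    ≡⟨ ∑-cong (λ {Q} Q∈ → ∑-trees-δ (relabel (flip σ) Q) (const (h Q))
                            (relabel-tree {F = Q} (flip σ) (to (∈-trees Q) Q∈))) ⟩
  ∑ TN h ∎
  where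
  open ≡-Reasoning
  TN : List (Family n)
  TN = trees n
  moved : ∀ S Q → relabel σ S ≡ Q ⇔ relabel (flip σ) Q ≡ S
  moved S Q = mk⇔ (λ { refl → relabel-inverse σ S }) (λ { refl → relabel-inverse (flip σ) Q })

marginal≡∑ : ∀ (k≤m : k ≤ m) pm Q →
             marginal k≤m pm Q ≡ ∑ (trees m) (λ S → 𝟙[ restrict k≤m S ≟ᶠ Q ] * pm S)
marginal≡∑ k≤m pm Q = trans (sumOver≡∑ _ pm)
  (∑-filter (λ S → ≡-dec _≟ᵇ_ (mask (restrict k≤m S)) (mask Q)) (trees _) pm)

module _ (k≤m : k ≤ m) (pm : Dist m) where
  private
    TM : List (Family m)
    TM = trees m
    TK : List (Family k)
    TK = trees k
    open ≡-Reasoning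

  ∑-marginal : 0 < k → ∀ (g : Family k → ℚ) →
               ∑ TK (λ Q → g Q * marginal k≤m pm Q) ≡ ∑ TM (λ S → g (restrict k≤m S) * pm S)
  ∑-marginal 0<k g = begin
    ∑ TK (λ Q → g Q * marginal k≤m pm Q)
      ≡⟨ ∑-cong (λ {Q} _ → trans (cong (g Q *_) (marginal≡∑ k≤m pm Q)) (sym (∑-*ˡ (g Q) (summand Q) TM))) ⟩
    ∑ TK (λ Q → ∑ TM (λ S → g Q * summand Q S))
      ≡⟨ ∑-comm TK TM (λ Q S → g Q * summand Q S) ⟩
    ∑ TM (λ S → ∑ TK (λ Q → g Q * summand Q S))
      ≡⟨ ∑-cong (λ {S} _ → ∑-cong (λ {Q} _ → x∙yz≈y∙xz (g Q) 𝟙[ restrict k≤m S ≟ᶠ Q ] (pm S))) ⟩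
    ∑ TM (λ S → ∑ TK (λ Q → 𝟙[ restrict k≤m S ≟ᶠ Q ] * (g Q * pm S)))
      ≡⟨ ∑-cong (λ {S} S∈ → ∑-trees-δ (restrict k≤m S) (λ Q → g Q * pm S)
                              (restrict-tree {S = S} k≤m 0<k (to (∈-trees S) S∈))) ⟩
    ∑ TM (λ S → g (restrict k≤m S) * pm S) ∎
    where
    summand : Family k → Family m → ℚ
    summand Q S = 𝟙[ restrict k≤m S ≟ᶠ Q ] * pm S

  marginal-isDistribution : 0 < k → IsDistribution m pm → IsDistribution k (marginal k≤m pm)
  marginal-isDistribution 0<k (nonneg , total) =
    (λ Q _ → subst (0ℚ ℚ.≤_) (sym (sumOver≡∑ _ pm))
               (∑-nonneg λ {S} S∈ → nonneg S (to (∈-trees S) (proj₁ (∈-filter⁻ _ {xs = TM} S∈))))) ,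
    (begin
      sumOver TK (marginal k≤m pm)          ≡⟨ sumOver≡∑ TK _ ⟩
      ∑ TK (marginal k≤m pm)                ≡⟨ ∑-cong (λ _ → *-identityˡ _) ⟨
      ∑ TK (λ Q → 1ℚ * marginal k≤m pm Q)   ≡⟨ ∑-marginal 0<k (const 1ℚ) ⟩
      ∑ TM (λ S → 1ℚ * pm S)                ≡⟨ ∑-cong (λ _ → *-identityˡ _) ⟩
      ∑ TM pm                               ≡⟨ sumOver≡∑ TM pm ⟨
      sumOver TM pm                         ≡⟨ total ⟩
      1ℚ ∎)

  marginal-exchangeable : Exchangeable m pm → Exchangeable k (marginal k≤m pm)
  marginal-exchangeable exchangeable σ Q _ = begin
    marginal k≤m pm (relabel σ Q)
      ≡⟨ marginal≡∑ k≤m pm (relabel σ Q) ⟩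
    ∑ TM (λ S → 𝟙[ restrict k≤m S ≟ᶠ relabel σ Q ] * pm S)
      ≡⟨ ∑-trees-relabel σ′ (λ S → 𝟙[ restrict k≤m S ≟ᶠ relabel σ Q ] * pm S) ⟨
    ∑ TM (λ S → 𝟙[ restrict k≤m (relabel σ′ S) ≟ᶠ relabel σ Q ] * pm (relabel σ′ S))
      ≡⟨ ∑-cong (λ {S} S∈ → let tS = to (∈-trees S) S∈ in
           cong₂ _*_ (𝟙-cong (restricted-relabel S tS) (restrict k≤m (relabel σ′ S) ≟ᶠ relabel σ Q)
                                                      (restrict k≤m S ≟ᶠ Q))
                     (exchangeable σ′ S tS)) ⟩
    ∑ TM (λ S → 𝟙[ restrict k≤m S ≟ᶠ Q ] * pm S)
      ≡⟨ marginal≡∑ k≤m pm Q ⟨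
    marginal k≤m pm Q ∎
    where
    σ′ : Permutation′ m
    σ′ = extend k≤m σ
    restricted-relabel : ∀ S → T (isTree S) →
                         restrict k≤m (relabel σ′ S) ≡ relabel σ Q ⇔ restrict k≤m S ≡ Q
    restricted-relabel S tS =
      relabel-cancel {F = restrict k≤m S} {G = Q} σ ⇔-∘ mk⇔ (trans (sym eq)) (trans eq)
      where
      eq : restrict k≤m (relabel σ′ S) ≡ relabel σ (restrict k≤m S)
      eq = restrict-relabel k≤m {S = S} σ tS

marginal-marginal : (n≤k : n ≤ k) (k≤m : k ≤ m) (n≤m : n ≤ m) → 0 < k → ∀ pm Tr →
                    marginal n≤k (marginal k≤m pm) Tr ≡ marginal n≤m pm Tr
marginal-marginal n≤k k≤m n≤m 0<k pm Tr = begin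
  marginal n≤k (marginal k≤m pm) Tr
    ≡⟨ marginal≡∑ n≤k _ Tr ⟩
  ∑ (trees _) (λ Q → 𝟙[ restrict n≤k Q ≟ᶠ Tr ] * marginal k≤m pm Q)
    ≡⟨ ∑-marginal k≤m pm 0<k (λ Q → 𝟙[ restrict n≤k Q ≟ᶠ Tr ]) ⟩
  ∑ (trees _) (λ S → 𝟙[ restrict n≤k (restrict k≤m S) ≟ᶠ Tr ] * pm S)
    ≡⟨ ∑-cong (λ {S} _ → cong (λ R → 𝟙[ R ≟ᶠ Tr ] * pm S) (restrict-restrict {S = S} n≤k k≤m n≤m)) ⟩
  ∑ (trees _) (λ S → 𝟙[ restrict n≤m S ≟ᶠ Tr ] * pm S)
    ≡⟨ marginal≡∑ n≤m pm Tr ⟨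
  marginal n≤m pm Tr ∎
  where open ≡-Reasoning

lemma2p4 : (n k m : ℕ) → 2 ≤ n → (n<k : n < k) → (k<m : k < m) →
    (p : Dist n) →
    EXsc n m (<⇒≤ (<-trans n<k k<m)) p → EXsc n k (<⇒≤ n<k) p
lemma2p4 n k m _ n<k k<m p (pm , (pm-distribution , pm-exchangeable) , p≡πₙpm) =
  marginal k≤m pm ,
  (marginal-isDistribution k≤m pm 0<k pm-distribution , marginal-exchangeable k≤m pm pm-exchangeable) ,
  λ Q tQ → trans (p≡πₙpm Q tQ) (sym (marginal-marginal (<⇒≤ n<k) k≤m (<⇒≤ (<-trans n<k k<m)) 0<k pm Q))
  where
  k≤m : k ≤ m
  k≤m = <⇒≤ k<m
  0<k : 0 < k
  0<k = ≤-trans (s≤s z≤n) n<k
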